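{- Let $p>0$ and $n\geq 4p$ be integers. Then there exists a globally simple integer Heffter array $H(n;4p)$.
   Context: A Heffter array $H(n;k)$ is an $n\times n$ array of integers (some cells may be empty) such that: each row and each column contains exactly $k$ filled cells; the entries in every row and every column sum to $0$ modulo $2nk+1$; and for each integer $1\leq x\leq nk$, either $x$ or $-x$ appears in the array. It is an integer Heffter array if every row sum and every column sum is $0$ in $\mathbb{Z}$. Rows and columns are indexed by $0,1,\dots,n-1$. The natural ordering of a row lists its filled cells from left to right (increasing column index), and the natural ordering of a column lists its filled cells from top to bottom (increasing row index). The array is globally simple if, for every row and every column, writing its entries in natural order as $a_0,a_1,\dots,a_{k-1}$, the partial sums $\sum_{j=0}^{i}a_j$ for $i=0,\dots,k-1$ are pairwise distinct modulo $2nk+1$. -}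

module Defs where

open import Data.Nat as ℕ using (ℕ; suc; _≤_; _<_)
open import Data.Integer as ℤ using (ℤ; +_; 0ℤ)
open import Data.Integer.Divisibility using (_∣_)
open import Data.Fin using (Fin)
open import Data.Maybe using (Maybe; just; nothing)
open import Data.List using (List; []; _∷_; map; mapMaybe; allFin; length; foldr)
open import Data.List.Relation.Unary.AllPairs using (AllPairs)
open import Data.Product using (∃; ∃₂; _×_)
open import Data.Sum using (_⊎_)
open import Relation.Binary.PropositionalEquality using (_≡_)
open import Relation.Nullary using (¬_)

-- An n×n partially filled array of integers: nothing = empty cell.
Array : ℕ → Set
Array n = Fin n → Fin n → Maybe ℤ

rowEntries : ∀ {n} → Array n → Fin n → List ℤ
rowEntries {n} A i = mapMaybe (λ j → A i j) (allFin n)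

colEntries : ∀ {n} → Array n → Fin n → List ℤ
colEntries {n} A j = mapMaybe (λ i → A i j) (allFin n)

sumℤ : List ℤ → ℤ
sumℤ = foldr ℤ._+_ 0ℤ

_≡[mod_]_ : ℤ → ℕ → ℤ → Set
a ≡[mod m ] b = (+ m) ∣ (a ℤ.- b)

partialSums : List ℤ → List ℤ
partialSums [] = []
partialSums (x ∷ xs) = x ∷ map (λ y → x ℤ.+ y) (partialSums xs)

modulus : ℕ → ℕ → ℕ
modulus n k = suc (2 ℕ.* n ℕ.* k)

record IsHeffter (n k : ℕ) (A : Array n) : Set where
  field
    rowCount : ∀ i → length (rowEntries A i) ≡ k
    colCount : ∀ j → length (colEntries A j) ≡ k
    rowSum   : ∀ i → sumℤ (rowEntries A i) ≡[mod modulus n k ] 0ℤ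
    colSum   : ∀ j → sumℤ (colEntries A j) ≡[mod modulus n k ] 0ℤ
    covers   : ∀ x → 1 ≤ x → x ≤ n ℕ.* k →
               ∃₂ λ i j → A i j ≡ just (+ x) ⊎ A i j ≡ just (ℤ.- (+ x))

record IsIntegerHeffter (n k : ℕ) (A : Array n) : Set where
  field
    heffter     : IsHeffter n k A
    rowSumZero  : ∀ i → sumℤ (rowEntries A i) ≡ 0ℤ
    colSumZero  : ∀ j → sumℤ (colEntries A j) ≡ 0ℤ

SimpleMod : ℕ → List ℤ → Set
SimpleMod m xs = AllPairs (λ a b → ¬ (a ≡[mod m ] b)) (partialSums xs)

record IsGloballySimple (n k : ℕ) (A : Array n) : Set where
  field
    rowSimple : ∀ i → SimpleMod (modulus n k) (rowEntries A i)
    colSimple : ∀ j → SimpleMod (modulus n k) (colEntries A j)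

module Submission where

-- The array fills the k = 4p cyclic diagonals d = j − i mod n with d < k.  Writing d = 4q + r,
-- cell (i, j) holds ±(n · band q r + 1 + (i + offset q r) mod n); band runs once through
-- 0, …, k − 1, so every magnitude 1, …, nk occurs exactly once.
-- Read from its diagonal-0 cell, a row has partial sums −2qn, a value in [1, n], −(2q+1)n and a
-- value below −(k−1)n after 4q, 4q+1, 4q+2 and 4q+3 entries: the terms (i + offset q r) mod n
-- cancel within each block, and the last block brings the sum back to 0.  A column read upwards
-- from its diagonal-0 cell behaves alike, except that its third partial sums are ≡ 1 modulo n.
-- These are distinct integers of absolute value at most nk, hence distinct modulo 2nk + 1.
-- In natural order every row is a cyclic rotation of such a sequence and every column a rotation
-- of a reversed one; for sequences summing to 0, rotation and reversal keep the partial sums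
-- distinct.

open import Defs
open import Function using (_∘_)
open import Data.Nat as ℕ using (ℕ; zero; suc; _+_; _*_; _∸_; _≤_; _<_; z≤n; s≤s; NonZero; _<?_; _≟_)
import Data.Nat.Properties as ℕP
open import Data.Nat.DivMod
open import Data.Nat.Divisibility as ℕ∣ using (divides; _∣0; ∣m+n∣m⇒∣n; n∣m*n; >⇒∤; ∣⇒≤)
open import Data.Nat.Tactic.RingSolver using () renaming (solve-∀ to solve-ℕ)
open import Data.Integer as ℤ using (ℤ; +_; 0ℤ)
import Data.Integer.Properties as ℤP
open import Data.Integer.Tactic.RingSolver using (solve-∀)
open import Data.Fin using (toℕ; fromℕ<)
open import Data.Fin.Properties using (toℕ<n; toℕ-fromℕ<)
open import Data.Maybe using (Maybe; just; nothing)
open import Data.List using (List; []; _∷_; _++_; [_]; _∷ʳ_; map; applyUpTo; upTo; mapMaybe; tabulate; allFin; length)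
open import Data.List.Properties
  using (map-applyUpTo; applyUpTo-∷ʳ; length-applyUpTo; mapMaybe-++; mapMaybe-map; ++-identityʳ; map-tabulate)
open import Data.List.Relation.Unary.AllPairs using (AllPairs)
open import Data.List.Relation.Unary.AllPairs.Properties using (applyUpTo⁺₁)
open import Data.Product using (Σ; ∃; ∃₂; _,_; _×_; proj₁; proj₂; map₂)
open import Data.Sum as Sum using (_⊎_; inj₁; inj₂)
open import Data.Empty using (⊥-elim)
open import Relation.Nullary using (¬_; yes; no)
open import Relation.Binary.PropositionalEquality hiding ([_])

psum : (ℕ → ℤ) → ℕ → ℤ
psum c zero    = 0ℤ
psum c (suc m) = psum c m ℤ.+ c m

psum-suc : ∀ c m → psum c (suc m) ≡ c 0 ℤ.+ psum (c ∘ suc) m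
psum-suc c zero    = trans (ℤP.+-identityˡ (c 0)) (sym (ℤP.+-identityʳ (c 0)))
psum-suc c (suc m) = trans (cong (ℤ._+ c (suc m)) (psum-suc c m)) (ℤP.+-assoc (c 0) _ (c (suc m)))

psum-+ : ∀ c a b → psum c (a + b) ≡ psum c a ℤ.+ psum (λ t → c (a + t)) b
psum-+ c a zero    rewrite ℕP.+-identityʳ a = sym (ℤP.+-identityʳ _)
psum-+ c a (suc b) rewrite ℕP.+-suc a b =
  trans (cong (ℤ._+ c (a + b)) (psum-+ c a b)) (ℤP.+-assoc (psum c a) _ _)

psum-cong-< : ∀ {c d} m → (∀ t → t < m → c t ≡ d t) → psum c m ≡ psum d m
psum-cong-< zero    c≡d = refl
psum-cong-< (suc m) c≡d = cong₂ ℤ._+_ (psum-cong-< m (λ t t<m → c≡d t (ℕP.m<n⇒m<1+n t<m))) (c≡d m ℕP.≤-refl)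

applyUpTo-cong-< : ∀ {A : Set} {f g : ℕ → A} m → (∀ t → t < m → f t ≡ g t) → applyUpTo f m ≡ applyUpTo g m
applyUpTo-cong-< zero    f≡g = refl
applyUpTo-cong-< (suc m) f≡g = cong₂ _∷_ (f≡g 0 (s≤s z≤n)) (applyUpTo-cong-< m (λ t t<m → f≡g (suc t) (s≤s t<m)))

partialSums-applyUpTo : ∀ c m → partialSums (applyUpTo c m) ≡ applyUpTo (psum c ∘ suc) m
partialSums-applyUpTo c zero    = refl
partialSums-applyUpTo c (suc m) = cong₂ _∷_ (sym (ℤP.+-identityˡ (c 0))) (begin
  map (λ y → c 0 ℤ.+ y) (partialSums (applyUpTo (c ∘ suc) m))
    ≡⟨ cong (map (λ y → c 0 ℤ.+ y)) (partialSums-applyUpTo (c ∘ suc) m) ⟩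
  map (λ y → c 0 ℤ.+ y) (applyUpTo (psum (c ∘ suc) ∘ suc) m)
    ≡⟨ map-applyUpTo _ (λ y → c 0 ℤ.+ y) m ⟩
  applyUpTo (λ t → c 0 ℤ.+ psum (c ∘ suc) (suc t)) m
    ≡⟨ applyUpTo-cong-< m (λ t _ → sym (psum-suc c (suc t))) ⟩
  applyUpTo (psum c ∘ suc ∘ suc) m
    ∎)
  where open ≡-Reasoning

sumℤ-applyUpTo : ∀ c m → sumℤ (applyUpTo c m) ≡ psum c m
sumℤ-applyUpTo c zero    = refl
sumℤ-applyUpTo c (suc m) = trans (cong (λ y → c 0 ℤ.+ y) (sumℤ-applyUpTo (c ∘ suc) m)) (sym (psum-suc c m))

≡[mod]-+ˡ : ∀ {M} c {a b} → a ≡[mod M ] b → (c ℤ.+ a) ≡[mod M ] (c ℤ.+ b)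
≡[mod]-+ˡ {M} c {a} {b} = subst (M ℕ∣.∣_) (cong ℤ.∣_∣ (sym (shift c a b)))
  where
  shift : ∀ c a b → (c ℤ.+ a) ℤ.- (c ℤ.+ b) ≡ a ℤ.- b
  shift = solve-∀

≡[mod]-neg : ∀ {M a b} → (ℤ.- a) ≡[mod M ] (ℤ.- b) → a ≡[mod M ] b
≡[mod]-neg {M} {a} {b} = subst (M ℕ∣.∣_) (trans (cong ℤ.∣_∣ (negate a b)) (ℤP.∣-i∣≡∣i∣ (a ℤ.- b)))
  where
  negate : ∀ a b → ℤ.- a ℤ.- ℤ.- b ≡ ℤ.- (a ℤ.- b)
  negate = solve-∀

≡[mod]-small⇒≡ : ∀ {M a b} → a ≡[mod M ] b → ℤ.∣ a ∣ + ℤ.∣ b ∣ < M → a ≡ b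
≡[mod]-small⇒≡ {M} {a} {b} M∣a-b small with ℤ.∣ a ℤ.- b ∣ in eq
... | zero  = ℤP.i-j≡0⇒i≡j a b (ℤP.∣i∣≡0⇒i≡0 eq)
... | suc d = ⊥-elim (ℕP.<-irrefl refl (ℕP.<-≤-trans small (begin
  M                        ≤⟨ ∣⇒≤ M∣a-b ⟩
  suc d                    ≡⟨ eq ⟨
  ℤ.∣ a ℤ.- b ∣            ≤⟨ ℤP.∣i-j∣≤∣i∣+∣j∣ a b ⟩
  ℤ.∣ a ∣ + ℤ.∣ b ∣        ∎)))
  where open ℕP.≤-Reasoning

%-+ˡ : ∀ a b n .{{_ : NonZero n}} → (a % n + b) % n ≡ (a + b) % n
%-+ˡ a b n = trans (%-distribˡ-+ (a % n) b n)
  (trans (cong (λ x → (x + b % n) % n) (m%n%n≡m%n a n)) (sym (%-distribˡ-+ a b n)))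

[r+q*d]/d≡q : ∀ q {r d} .{{_ : NonZero d}} → r < d → (r + q * d) / d ≡ q
[r+q*d]/d≡q q {r} {d} r<d = trans (+-distrib-/-∣ʳ r (divides q refl)) (cong₂ _+_ (m<n⇒m/n≡0 r<d) (m*n/n≡m q d))

[r+q*d]%d≡r : ∀ q {r d} .{{_ : NonZero d}} → r < d → (r + q * d) % d ≡ r
[r+q*d]%d≡r q {r} {d} r<d = trans ([m+kn]%n≡m%n r q d) (m<n⇒m%n≡m r<d)

∣∧<⇒≡0 : ∀ {n δ} → n ℕ∣.∣ δ → δ < n → δ ≡ 0
∣∧<⇒≡0 {δ = zero}  _   _   = refl
∣∧<⇒≡0 {δ = suc _} n∣δ δ<n = ⊥-elim (>⇒∤ δ<n n∣δ)

%-+-stable⇒∣ : ∀ w δ n .{{_ : NonZero n}} → (w + δ) % n ≡ w % n → n ℕ∣.∣ δ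
%-+-stable⇒∣ w δ n stable = ∣m+n∣m⇒∣n (subst (n ℕ∣.∣_) (sym quotients) (n∣m*n ((w + δ) / n))) (n∣m*n (w / n))
  where
  open ≡-Reasoning
  quotients : (w / n) * n + δ ≡ ((w + δ) / n) * n
  quotients = ℕP.+-cancelˡ-≡ (w % n) _ _ (begin
    w % n + ((w / n) * n + δ)    ≡⟨ ℕP.+-assoc (w % n) _ δ ⟨
    w % n + (w / n) * n + δ      ≡⟨ cong (_+ δ) (m≡m%n+[m/n]*n w n) ⟨
    w + δ                        ≡⟨ m≡m%n+[m/n]*n (w + δ) n ⟩
    (w + δ) % n + ((w + δ) / n) * n  ≡⟨ cong (_+ ((w + δ) / n) * n) stable ⟩
    w % n + ((w + δ) / n) * n    ∎)

%-+-injective-≤ : ∀ z {a b} n .{{_ : NonZero n}} → a ≤ b → b ∸ a < n → (z + a) % n ≡ (z + b) % n → a ≡ b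
%-+-injective-≤ z {a} {b} n a≤b b∸a<n eq =
  ℕP.≤-antisym a≤b (ℕP.m∸n≡0⇒m≤n (∣∧<⇒≡0 (%-+-stable⇒∣ (z + a) (b ∸ a) n stable) b∸a<n))
  where
  stable : (z + a + (b ∸ a)) % n ≡ (z + a) % n
  stable = trans (cong (_% n) (trans (ℕP.+-assoc z a _) (cong (λ y → z + y) (ℕP.m+[n∸m]≡n a≤b)))) (sym eq)

%-+-injective : ∀ z {a b} n .{{_ : NonZero n}} → a < n → b < n → (z + a) % n ≡ (z + b) % n → a ≡ b
%-+-injective z {a} {b} n a<n b<n eq with ℕP.≤-total a b
... | inj₁ a≤b = %-+-injective-≤ z n a≤b (ℕP.≤-<-trans (ℕP.m∸n≤m b a) b<n) eq
... | inj₂ b≤a = sym (%-+-injective-≤ z n b≤a (ℕP.≤-<-trans (ℕP.m∸n≤m a b) a<n) (sym eq))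

%-+-∸-injective-≤ : ∀ z {a b} n .{{_ : NonZero n}} → a ≤ b → b < n →
                    (z + (n ∸ a)) % n ≡ (z + (n ∸ b)) % n → a ≡ b
%-+-∸-injective-≤ z {a} {b} n a≤b b<n eq = sym (ℕP.∸-cancelˡ-≡ (ℕP.<⇒≤ b<n) (ℕP.≤-trans a≤b (ℕP.<⇒≤ b<n))
  (%-+-injective-≤ z n (ℕP.∸-monoʳ-≤ n a≤b) gap (sym eq)))
  where
  gap : (n ∸ a) ∸ (n ∸ b) < n
  gap = ℕP.≤-<-trans (ℕP.∸-monoˡ-≤ (n ∸ b) (ℕP.m∸n≤m n a)) (subst (_< n) (sym (ℕP.m∸[m∸n]≡n (ℕP.<⇒≤ b<n))) b<n)

%-+-∸-injective : ∀ z {a b} n .{{_ : NonZero n}} → a < n → b < n →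
                  (z + (n ∸ a)) % n ≡ (z + (n ∸ b)) % n → a ≡ b
%-+-∸-injective z {a} {b} n a<n b<n eq with ℕP.≤-total a b
... | inj₁ a≤b = %-+-∸-injective-≤ z n a≤b b<n eq
... | inj₂ b≤a = sym (%-+-∸-injective-≤ z n b≤a a<n (sym eq))

-- Rotating and reversing a sequence that sums to zero

psum-shift : ∀ f r s → psum (λ t → f (r + t)) s ≡ psum f (r + s) ℤ.- psum f r
psum-shift f r s = trans (cancel (psum f r) _) (cong (ℤ._- psum f r) (sym (psum-+ f r s)))
  where
  cancel : ∀ a b → b ≡ (a ℤ.+ b) ℤ.- a
  cancel = solve-∀

DistinctPartialSums : ℕ → ℕ → (ℕ → ℤ) → Set
DistinctPartialSums M k c = ∀ {x y} → x < k → y < k → psum c x ≡[mod M ] psum c y → x ≡ y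

cyclic : ∀ {A : Set} (k : ℕ) .{{_ : NonZero k}} → (ℕ → A) → ℕ → A
cyclic k c t = c (t % k)

module _ {k} .{{_ : NonZero k}} {c : ℕ → ℤ} where

  psum-cyclic-≤ : ∀ {x} → x ≤ k → psum (cyclic k c) x ≡ psum c x
  psum-cyclic-≤ x≤k = psum-cong-< _ (λ t t<x → cong c (m<n⇒m%n≡m (ℕP.<-≤-trans t<x x≤k)))

  module _ (closed : psum c k ≡ 0ℤ) where

    psum-%-≤ : ∀ {x} → x ≤ k → psum c (x % k) ≡ psum c x
    psum-%-≤ {x} x≤k with ℕP.m≤n⇒m<n∨m≡n x≤k
    ... | inj₁ x<k  = cong (psum c) (m<n⇒m%n≡m x<k)
    ... | inj₂ refl = trans (cong (psum c) (n%n≡0 k)) (sym closed)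

    psum-cyclic-+k : ∀ x → psum (cyclic k c) (k + x) ≡ psum (cyclic k c) x
    psum-cyclic-+k x = begin
      psum (cyclic k c) (k + x)                                    ≡⟨ psum-+ (cyclic k c) k x ⟩
      psum (cyclic k c) k ℤ.+ psum (λ t → cyclic k c (k + t)) x    ≡⟨ cong₂ ℤ._+_ (trans (psum-cyclic-≤ ℕP.≤-refl) closed)
                                                                                  (psum-cong-< x (λ t _ → period t)) ⟩
      0ℤ ℤ.+ psum (cyclic k c) x                                   ≡⟨ ℤP.+-identityˡ _ ⟩
      psum (cyclic k c) x                                          ∎
      where
      open ≡-Reasoning
      period : ∀ t → cyclic k c (k + t) ≡ cyclic k c t
      period t = cong c (trans (cong (_% k) (ℕP.+-comm k t)) ([m+n]%n≡m%n t k))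

    psum-cyclic : ∀ z → psum (cyclic k c) z ≡ psum c (z % k)
    psum-cyclic z = begin
      psum (cyclic k c) z                         ≡⟨ cong (psum (cyclic k c)) (trans (m≡m%n+[m/n]*n z k) (ℕP.+-comm (z % k) _)) ⟩
      psum (cyclic k c) ((z / k) * k + z % k)     ≡⟨ drop-periods (z / k) (z % k) ⟩
      psum (cyclic k c) (z % k)                   ≡⟨ psum-cyclic-≤ (ℕP.<⇒≤ (m%n<n z k)) ⟩
      psum c (z % k)                              ∎
      where
      open ≡-Reasoning
      drop-periods : ∀ q a → psum (cyclic k c) (q * k + a) ≡ psum (cyclic k c) a
      drop-periods zero    a = refl
      drop-periods (suc q) a = trans (cong (psum (cyclic k c)) (ℕP.+-assoc k (q * k) a))
                                     (trans (psum-cyclic-+k (q * k + a)) (drop-periods q a))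

    sumℤ-rotation : ∀ r → sumℤ (applyUpTo (λ t → cyclic k c (r + t)) k) ≡ 0ℤ
    sumℤ-rotation r = begin
      sumℤ (applyUpTo (λ t → cyclic k c (r + t)) k)      ≡⟨ sumℤ-applyUpTo _ k ⟩
      psum (λ t → cyclic k c (r + t)) k                  ≡⟨ psum-shift (cyclic k c) r k ⟩
      psum (cyclic k c) (r + k) ℤ.- psum (cyclic k c) r  ≡⟨ cong (ℤ._- psum (cyclic k c) r)
                                                             (trans (cong (psum (cyclic k c)) (ℕP.+-comm r k)) (psum-cyclic-+k r)) ⟩
      psum (cyclic k c) r ℤ.- psum (cyclic k c) r        ≡⟨ ℤP.+-inverseʳ (psum (cyclic k c) r) ⟩
      0ℤ                                                 ∎
      where open ≡-Reasoning

    -- The partial sums of a rotation are those of c shifted by a constant and read at residues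
    -- modulo k, because c sums to 0.
    simpleMod-rotation : ∀ {M} → DistinctPartialSums M k c →
                         ∀ r → SimpleMod M (applyUpTo (λ t → cyclic k c (r + t)) k)
    simpleMod-rotation {M} distinct r =
      subst (AllPairs _) (sym (partialSums-applyUpTo _ k)) (applyUpTo⁺₁ _ k apart)
      where
      apart : ∀ {i j} → i < j → j < k →
              ¬ (psum (λ t → cyclic k c (r + t)) (suc i) ≡[mod M ] psum (λ t → cyclic k c (r + t)) (suc j))
      apart {i} {j} i<j j<k shifted≡ = ℕP.<-irrefl (ℕP.suc-injective same-offset) i<j
        where
        unshift : ∀ s → psum (cyclic k c) r ℤ.+ psum (λ t → cyclic k c (r + t)) s ≡ psum c ((r + s) % k)
        unshift s = trans (sym (psum-+ (cyclic k c) r s)) (psum-cyclic (r + s))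
        same-offset : suc i ≡ suc j
        same-offset = %-+-injective-≤ r k (ℕP.<⇒≤ (s≤s i<j)) (ℕP.≤-<-trans (ℕP.m∸n≤m j i) j<k)
          (distinct (m%n<n _ k) (m%n<n _ k)
            (subst₂ (λ a b → a ≡[mod M ] b) (unshift (suc i)) (unshift (suc j))
              (≡[mod]-+ˡ (psum (cyclic k c) r) shifted≡)))

reversed : ℕ → (ℕ → ℤ) → ℕ → ℤ
reversed k c t = c (k ∸ suc t)

psum-reversed : ∀ k c {x} → x ≤ k → psum (reversed k c) x ℤ.+ psum c (k ∸ x) ≡ psum c k
psum-reversed k c {zero}  _    = ℤP.+-identityˡ _
psum-reversed k c {suc x} sx≤k = begin
  psum (reversed k c) x ℤ.+ c (k ∸ suc x) ℤ.+ psum c (k ∸ suc x)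
    ≡⟨ regroup (psum (reversed k c) x) _ _ ⟩
  psum (reversed k c) x ℤ.+ psum c (suc (k ∸ suc x))
    ≡⟨ cong (λ m → psum (reversed k c) x ℤ.+ psum c m) (ℕP.+-∸-assoc 1 sx≤k) ⟨
  psum (reversed k c) x ℤ.+ psum c (k ∸ x)
    ≡⟨ psum-reversed k c (ℕP.<⇒≤ sx≤k) ⟩
  psum c k
    ∎
  where
  open ≡-Reasoning
  regroup : ∀ a b s → a ℤ.+ b ℤ.+ s ≡ a ℤ.+ (s ℤ.+ b)
  regroup = solve-∀

module _ {k} .{{_ : NonZero k}} {c : ℕ → ℤ} (closed : psum c k ≡ 0ℤ) where

  psum-reversed-closed : ∀ {x} → x ≤ k → psum (reversed k c) x ≡ ℤ.- psum c (k ∸ x)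
  psum-reversed-closed {x} x≤k = begin
    psum (reversed k c) x
      ≡⟨ add-and-subtract _ (psum c (k ∸ x)) ⟩
    psum (reversed k c) x ℤ.+ psum c (k ∸ x) ℤ.- psum c (k ∸ x)
      ≡⟨ cong (ℤ._- psum c (k ∸ x)) (trans (psum-reversed k c x≤k) closed) ⟩
    0ℤ ℤ.- psum c (k ∸ x)
      ≡⟨ ℤP.+-identityˡ _ ⟩
    ℤ.- psum c (k ∸ x)
      ∎
    where
    open ≡-Reasoning
    add-and-subtract : ∀ a b → a ≡ a ℤ.+ b ℤ.- b
    add-and-subtract = solve-∀

  reversed-closed : psum (reversed k c) k ≡ 0ℤ
  reversed-closed = trans (psum-reversed-closed ℕP.≤-refl) (cong (λ m → ℤ.- psum c m) (ℕP.n∸n≡0 k))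

  reversed-distinct : ∀ {M} → DistinctPartialSums M k c → DistinctPartialSums M k (reversed k c)
  reversed-distinct {M} distinct {x} {y} x<k y<k rev≡ =
    %-+-∸-injective 0 k x<k y<k (distinct (m%n<n _ k) (m%n<n _ k) (subst₂ (λ a b → a ≡[mod M ] b)
      (sym (psum-%-≤ closed (ℕP.m∸n≤m k x))) (sym (psum-%-≤ closed (ℕP.m∸n≤m k y))) complements≡))
    where
    complements≡ : psum c (k ∸ x) ≡[mod M ] psum c (k ∸ y)
    complements≡ = ≡[mod]-neg {a = psum c (k ∸ x)} {b = psum c (k ∸ y)} (subst₂ (λ a b → a ≡[mod M ] b)
      (psum-reversed-closed (ℕP.<⇒≤ x<k)) (psum-reversed-closed (ℕP.<⇒≤ y<k)) rev≡)

-- The filled cells of a cyclic window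

applyUpTo-++ : ∀ {A : Set} (f : ℕ → A) a b → applyUpTo f (a + b) ≡ applyUpTo f a ++ applyUpTo (λ t → f (a + t)) b
applyUpTo-++ f zero    b = refl
applyUpTo-++ f (suc a) b = cong (f 0 ∷_) (applyUpTo-++ (f ∘ suc) a b)

rotate₁ : ∀ {A : Set} → List A → List A
rotate₁ []       = []
rotate₁ (x ∷ xs) = xs ∷ʳ x

applyUpTo-rotate₁ : ∀ {A : Set} (f : ℕ → A) m → f m ≡ f 0 → rotate₁ (applyUpTo f m) ≡ applyUpTo (f ∘ suc) m
applyUpTo-rotate₁ f zero    _        = refl
applyUpTo-rotate₁ f (suc m) fm≡f0 = trans (cong (applyUpTo (f ∘ suc) m ∷ʳ_) (sym fm≡f0)) (applyUpTo-∷ʳ (f ∘ suc) m)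

module _ {A B : Set} (g : A → Maybe B) where

  mapMaybe-rotate₁ : ∀ xs → mapMaybe g (rotate₁ xs) ≡ mapMaybe g xs
                          ⊎ mapMaybe g (rotate₁ xs) ≡ rotate₁ (mapMaybe g xs)
  mapMaybe-rotate₁ []       = inj₁ refl
  mapMaybe-rotate₁ (x ∷ xs) rewrite mapMaybe-++ g xs [ x ] with g x
  ... | nothing = inj₁ (++-identityʳ (mapMaybe g xs))
  ... | just y  = inj₂ refl

  mapMaybe-applyUpTo-just : ∀ (f : ℕ → A) (h : ℕ → B) m → (∀ t → t < m → g (f t) ≡ just (h t)) →
                            mapMaybe g (applyUpTo f m) ≡ applyUpTo h m
  mapMaybe-applyUpTo-just f h zero    _      = refl
  mapMaybe-applyUpTo-just f h (suc m) filled rewrite filled 0 (s≤s z≤n) =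
    cong (h 0 ∷_) (mapMaybe-applyUpTo-just (f ∘ suc) (h ∘ suc) m (λ t t<m → filled (suc t) (s≤s t<m)))

  mapMaybe-applyUpTo-nothing : ∀ (f : ℕ → A) m → (∀ t → t < m → g (f t) ≡ nothing) → mapMaybe g (applyUpTo f m) ≡ []
  mapMaybe-applyUpTo-nothing f zero    _     = refl
  mapMaybe-applyUpTo-nothing f (suc m) empty rewrite empty 0 (s≤s z≤n) =
    mapMaybe-applyUpTo-nothing (f ∘ suc) m (λ t t<m → empty (suc t) (s≤s t<m))

rotate₁-applyUpTo-% : ∀ {A : Set} (f : ℕ → A) m .{{_ : NonZero m}} s →
  rotate₁ (applyUpTo (λ t → f ((s + t) % m)) m) ≡ applyUpTo (λ t → f ((suc s + t) % m)) m
rotate₁-applyUpTo-% f m s =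
  trans (applyUpTo-rotate₁ _ m (cong f (trans ([m+n]%n≡m%n s m) (cong (_% m) (sym (ℕP.+-identityʳ s))))))
        (applyUpTo-cong-< m (λ t _ → cong (λ u → f (u % m)) (ℕP.+-suc s t)))

cycleFrom : (n : ℕ) .{{_ : NonZero n}} → ℕ → List ℕ
cycleFrom n s = applyUpTo (λ t → (s + t) % n) n

cycleFrom-suc : ∀ n .{{_ : NonZero n}} s → cycleFrom n (suc s) ≡ rotate₁ (cycleFrom n s)
cycleFrom-suc n s = sym (rotate₁-applyUpTo-% (λ u → u) n s)

module _ {B : Set} (g : ℕ → Maybe B) (h : ℕ → B) {n k} .{{_ : NonZero n}} .{{_ : NonZero k}} where

  private
    Reachable : ℕ → Set
    Reachable s = ∃ λ r → mapMaybe g (cycleFrom n s) ≡ applyUpTo (λ t → cyclic k h (r + t)) k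

    -- Moving the start one cell ahead rotates the filled entries by one place, or leaves them
    -- unchanged when the cell passed over is empty.
    step : ∀ {s} → Reachable s → Reachable (suc s)
    step {s} (r , eq) with mapMaybe-rotate₁ g (cycleFrom n s)
    ... | inj₁ unchanged = r , trans (cong (mapMaybe g) (cycleFrom-suc n s)) (trans unchanged eq)
    ... | inj₂ rotated   = suc r , trans (cong (mapMaybe g) (cycleFrom-suc n s))
                                     (trans rotated (trans (cong rotate₁ eq) (rotate₁-applyUpTo-% h k r)))

  mapMaybe-window : ∀ s → s < n → k ≤ n →
    (∀ t → t < k → g ((s + t) % n) ≡ just (h t)) →
    (∀ t → k ≤ t → t < n → g ((s + t) % n) ≡ nothing) →
    ∃ λ r → mapMaybe g (upTo n) ≡ applyUpTo (λ t → cyclic k h (r + t)) k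
  mapMaybe-window s s<n k≤n filled empty =
    map₂ (trans (cong (mapMaybe g) (sym cycleFrom-n))) (subst Reachable (ℕP.m+[n∸m]≡n (ℕP.<⇒≤ s<n)) (reach (n ∸ s)))
    where
    open ≡-Reasoning
    cycleFrom-n : cycleFrom n n ≡ upTo n
    cycleFrom-n = applyUpTo-cong-< n (λ t t<n → trans (cong (_% n) (ℕP.+-comm n t)) (trans ([m+n]%n≡m%n t n) (m<n⇒m%n≡m t<n)))
    start : Reachable s
    start = 0 , (begin
      mapMaybe g (cycleFrom n s)
        ≡⟨ cong (λ m → mapMaybe g (applyUpTo (λ t → (s + t) % n) m)) (ℕP.m+[n∸m]≡n k≤n) ⟨
      mapMaybe g (applyUpTo (λ t → (s + t) % n) (k + (n ∸ k)))
        ≡⟨ cong (mapMaybe g) (applyUpTo-++ _ k (n ∸ k)) ⟩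
      mapMaybe g (applyUpTo (λ t → (s + t) % n) k ++ applyUpTo (λ t → (s + (k + t)) % n) (n ∸ k))
        ≡⟨ mapMaybe-++ g (applyUpTo (λ t → (s + t) % n) k) _ ⟩
      mapMaybe g (applyUpTo (λ t → (s + t) % n) k) ++ mapMaybe g (applyUpTo (λ t → (s + (k + t)) % n) (n ∸ k))
        ≡⟨ cong₂ _++_ (mapMaybe-applyUpTo-just g _ h k filled)
                      (mapMaybe-applyUpTo-nothing g _ (n ∸ k) (λ t t<n∸k → empty (k + t) (ℕP.m≤m+n k t)
                          (subst (k + t <_) (ℕP.m+[n∸m]≡n k≤n) (ℕP.+-monoʳ-< k t<n∸k)))) ⟩
      applyUpTo h k ++ []
        ≡⟨ ++-identityʳ _ ⟩
      applyUpTo h k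
        ≡⟨ applyUpTo-cong-< k (λ t t<k → cong h (sym (m<n⇒m%n≡m t<k))) ⟩
      applyUpTo (λ t → cyclic k h (0 + t)) k
        ∎)
    reach : ∀ m → Reachable (s + m)
    reach zero    = subst Reachable (sym (ℕP.+-identityʳ s)) start
    reach (suc m) = subst Reachable (sym (ℕP.+-suc s m)) (step (reach m))

tabulate-toℕ : ∀ {A : Set} n (f : ℕ → A) → tabulate {n = n} (f ∘ toℕ) ≡ applyUpTo f n
tabulate-toℕ zero    f = refl
tabulate-toℕ (suc n) f = cong (f 0 ∷_) (tabulate-toℕ n (f ∘ suc))

mapMaybe-allFin : ∀ {B : Set} n (g : ℕ → Maybe B) → mapMaybe (g ∘ toℕ) (allFin n) ≡ mapMaybe g (upTo n)
mapMaybe-allFin n g = trans (sym (mapMaybe-map g toℕ (allFin n)))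
                            (cong (mapMaybe g) (trans (map-tabulate (λ i → i) toℕ) (tabulate-toℕ n (λ t → t))))

-- The array

module Construction (p′ n′ : ℕ) (k≤n : 4 * suc p′ ≤ suc n′) where

  p n k k₁ : ℕ
  p  = suc p′
  n  = suc n′
  k  = 4 * p
  k₁ = k ∸ 1

  M : ℕ
  M = modulus n k

  -- Block q takes the bands 2q, 2q+1, k−2−2q and k−3−2q, except that the last block takes k−1
  -- in place of k−3−2q = 2p−1, which is already band (p−1) 1.
  band : ℕ → ℕ → ℕ
  band q 0 = 2 * q
  band q 1 = suc (2 * q)
  band q 2 = k₁ ∸ suc (2 * q)
  band q (suc (suc (suc _))) with suc q ≟ p
  ... | yes _ = k₁
  ... | no  _ = k₁ ∸ suc (suc (2 * q))

  offset : ℕ → ℕ → ℕ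
  offset q 0 = 2 * q
  offset q 1 = 2 * q
  offset q (suc (suc _)) = suc (suc (2 * q))

  sign : ℕ → ℤ → ℤ
  sign 0 z = z
  sign 1 z = ℤ.- z
  sign 2 z = ℤ.- z
  sign (suc (suc (suc _))) z = z

  blockEntry : ℕ → ℕ → ℕ → ℤ
  blockEntry i q r = sign r (+ (n * band q r + suc ((i + offset q r) % n)))

  entry : ℕ → ℕ → ℤ
  entry i d = blockEntry i (d / 4) (d % 4)

  diag : ℕ → ℕ → ℕ
  diag i j = (j + (n ∸ i)) % n

  cell : ℕ → ℕ → Maybe ℤ
  cell i j with diag i j <? k
  ... | yes _ = just (entry i (diag i j))
  ... | no  _ = nothing

  array : Array n
  array i j = cell (toℕ i) (toℕ j)

  k≡4+p′*4 : k ≡ 4 + p′ * 4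
  k≡4+p′*4 = identity p′
    where
    identity : ∀ a → 4 * suc a ≡ 4 + a * 4
    identity = solve-ℕ

  2q+1<k₁ : ∀ {q} → q < p → suc (2 * q) < k₁
  2q+1<k₁ {q} (s≤s q≤p′) = begin-strict
    suc (2 * q)        <⟨ ℕP.n<1+n _ ⟩
    suc (suc (2 * q))  ≡⟨ ℕP.*-suc 2 q ⟨
    2 * suc q          ≤⟨ ℕP.*-monoʳ-≤ 2 (s≤s q≤p′) ⟩
    2 * p              ≤⟨ ℕP.m≤m+n (2 * p) (suc (2 * p′)) ⟩
    2 * p + suc (2 * p′) ≡⟨ identity p′ ⟩
    k₁                 ∎
    where
    open ℕP.≤-Reasoning
    identity : ∀ a → 2 * suc a + suc (2 * a) ≡ a + 3 * suc a
    identity = solve-ℕ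

  2q<k₁ : ∀ {q} → q < p → 2 * q < k₁
  2q<k₁ q<p = ℕP.<-trans (ℕP.n<1+n _) (2q+1<k₁ q<p)

  k₁<n : k₁ < n
  k₁<n = ℕP.<-≤-trans (ℕP.n<1+n k₁) k≤n

  2q+2<n : ∀ {q} → q < p → suc (suc (2 * q)) < n
  2q+2<n q<p = ℕP.<-≤-trans (s≤s (2q+1<k₁ q<p)) k≤n

  2q+1<n : ∀ {q} → q < p → suc (2 * q) < n
  2q+1<n q<p = ℕP.<-trans (ℕP.n<1+n _) (2q+2<n q<p)

  2q<n : ∀ {q} → q < p → 2 * q < n
  2q<n q<p = ℕP.<-trans (2q<k₁ q<p) k₁<n

  band-last : band p′ 3 ≡ k₁
  band-last with suc p′ ≟ p
  ... | yes _   = refl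
  ... | no  p≢p = ⊥-elim (p≢p refl)

  band-3 : ∀ {q} → suc q < p → band q 3 ≡ k₁ ∸ suc (suc (2 * q))
  band-3 {q} sq<p with suc q ≟ p
  ... | yes sq≡p = ⊥-elim (ℕP.<-irrefl sq≡p sq<p)
  ... | no  _    = refl

  n*k₁-split : ∀ {q} → q < p → n * suc (2 * q) + n * band q 2 ≡ n * k₁
  n*k₁-split {q} q<p = trans (sym (ℕP.*-distribˡ-+ n (suc (2 * q)) (band q 2)))
                             (cong (n *_) (ℕP.m+[n∸m]≡n (ℕP.<⇒≤ (2q+1<k₁ q<p))))

  n*k₁-split′ : ∀ {q} → suc q < p → n * (2 * suc q) + n * band q 3 ≡ n * k₁
  n*k₁-split′ {q} sq<p = begin
    n * (2 * suc q) + n * band q 3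
      ≡⟨ cong₂ (λ a b → n * a + n * b) (ℕP.*-suc 2 q) (band-3 sq<p) ⟩
    n * suc (suc (2 * q)) + n * (k₁ ∸ suc (suc (2 * q)))
      ≡⟨ ℕP.*-distribˡ-+ n (suc (suc (2 * q))) (k₁ ∸ suc (suc (2 * q))) ⟨
    n * (suc (suc (2 * q)) + (k₁ ∸ suc (suc (2 * q))))
      ≡⟨ cong (n *_) (ℕP.m+[n∸m]≡n (2q+1<k₁ (ℕP.<-trans (ℕP.n<1+n q) sq<p))) ⟩
    n * k₁
      ∎
    where open ≡-Reasoning

  entry-block : ∀ i q {r} → r < 4 → entry i (r + q * 4) ≡ blockEntry i q r
  entry-block i q r<4 = cong₂ (blockEntry i) ([r+q*d]/d≡q q r<4) ([r+q*d]%d≡r q r<4)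

  block-< : ∀ {q r} → q < p → r < 4 → r + q * 4 < k
  block-< {q} {r} q<p r<4 = ℕP.<-≤-trans (ℕP.+-monoˡ-< (q * 4) r<4)
    (ℕP.≤-trans (ℕP.*-monoˡ-≤ 4 q<p) (ℕP.≤-reflexive (ℕP.*-comm p 4)))

  diag-of : ∀ {x j d} → x < n → d < n → (x + d) % n ≡ j → diag x j ≡ d
  diag-of {x} {j} {d} x<n d<n x+d≡j = begin
    (j + (n ∸ x)) % n               ≡⟨ cong (λ y → (y + (n ∸ x)) % n) x+d≡j ⟨
    ((x + d) % n + (n ∸ x)) % n     ≡⟨ %-+ˡ (x + d) (n ∸ x) n ⟩
    (x + d + (n ∸ x)) % n           ≡⟨ cong (_% n) (solve-around x d (n ∸ x)) ⟩
    (d + (x + (n ∸ x))) % n         ≡⟨ cong (λ y → (d + y) % n) (ℕP.m+[n∸m]≡n (ℕP.<⇒≤ x<n)) ⟩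
    (d + n) % n                     ≡⟨ [m+n]%n≡m%n d n ⟩
    d % n                           ≡⟨ m<n⇒m%n≡m d<n ⟩
    d                               ∎
    where
    open ≡-Reasoning
    solve-around : ∀ a b c → a + b + c ≡ b + (a + c)
    solve-around = solve-ℕ

  cell-filled : ∀ {i j} → diag i j < k → cell i j ≡ just (entry i (diag i j))
  cell-filled {i} {j} lt with diag i j <? k
  ... | yes _ = refl
  ... | no ¬lt = ⊥-elim (¬lt lt)

  cell-empty : ∀ {i j} → k ≤ diag i j → cell i j ≡ nothing
  cell-empty {i} {j} ge with diag i j <? k
  ... | yes lt = ⊥-elim (ℕP.<-irrefl refl (ℕP.<-≤-trans lt ge))
  ... | no _   = refl

  diag-+ : ∀ {i j} → i ≤ n → j < n → (diag i j + i) % n ≡ j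
  diag-+ {i} {j} i≤n j<n = begin
    ((j + (n ∸ i)) % n + i) % n     ≡⟨ %-+ˡ (j + (n ∸ i)) i n ⟩
    (j + (n ∸ i) + i) % n           ≡⟨ cong (_% n) (trans (ℕP.+-assoc j _ i) (cong (λ y → j + y) (ℕP.m∸n+n≡m i≤n))) ⟩
    (j + n) % n                     ≡⟨ [m+n]%n≡m%n j n ⟩
    j % n                           ≡⟨ m<n⇒m%n≡m j<n ⟩
    j                               ∎
    where open ≡-Reasoning

  diag-+-offset : ∀ {j d t e} → e + t ≡ d → d ≤ n → (diag d j + t) % n ≡ (j + (n ∸ e)) % n
  diag-+-offset {j} {d} {t} {e} e+t≡d d≤n = begin
    ((j + (n ∸ d)) % n + t) % n    ≡⟨ %-+ˡ (j + (n ∸ d)) t n ⟩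
    (j + (n ∸ d) + t) % n          ≡⟨ cong (_% n) (ℕP.+-assoc j (n ∸ d) t) ⟩
    (j + ((n ∸ d) + t)) % n        ≡⟨ cong (λ m → (j + (n ∸ m + t)) % n) e+t≡d ⟨
    (j + ((n ∸ (e + t)) + t)) % n  ≡⟨ cong (λ m → (j + (m + t)) % n) (ℕP.∸-+-assoc n e t) ⟨
    (j + ((n ∸ e ∸ t) + t)) % n    ≡⟨ cong (λ m → (j + m) % n) (ℕP.m∸n+n≡m t≤n∸e) ⟩
    (j + (n ∸ e)) % n              ∎
    where
    open ≡-Reasoning
    t≤n∸e : t ≤ n ∸ e
    t≤n∸e = ℕP.m+n≤o⇒m≤o∸n t (subst (_≤ n) (trans (sym e+t≡d) (ℕP.+-comm e t)) d≤n)

  rowEntries-rotation : ∀ i → ∃ λ r → rowEntries array i ≡ applyUpTo (λ t → cyclic k (entry (toℕ i)) (r + t)) k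
  rowEntries-rotation i =
    map₂ (trans (mapMaybe-allFin n (cell x))) (mapMaybe-window (cell x) (entry x) x (toℕ<n i) k≤n filled empty)
    where
    x = toℕ i
    filled : ∀ t → t < k → cell x ((x + t) % n) ≡ just (entry x t)
    filled t t<k = trans (cell-filled (subst (_< k) (sym diag≡t) t<k)) (cong (just ∘ entry x) diag≡t)
      where diag≡t = diag-of (toℕ<n i) (ℕP.<-≤-trans t<k k≤n) refl
    empty : ∀ t → k ≤ t → t < n → cell x ((x + t) % n) ≡ nothing
    empty t k≤t t<n = cell-empty (subst (k ≤_) (sym (diag-of (toℕ<n i) t<n refl)) k≤t)

  colEntry : ℕ → ℕ → ℤ
  colEntry j d = entry (diag d j) d

  -- Top to bottom, column j meets the diagonals in decreasing cyclic order, starting with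
  -- diagonal k−1 in row columnStart j.
  columnStart : ℕ → ℕ
  columnStart j = diag k₁ j

  columnStart-+ : ∀ {j t d} m → j < n → t + d ≡ k₁ + m * n → ((columnStart j + t) % n + d) % n ≡ j
  columnStart-+ {j} {t} {d} m j<n t+d≡ = begin
    ((columnStart j + t) % n + d) % n   ≡⟨ %-+ˡ (columnStart j + t) d n ⟩
    (columnStart j + t + d) % n         ≡⟨ cong (_% n) (ℕP.+-assoc (columnStart j) t d) ⟩
    (columnStart j + (t + d)) % n       ≡⟨ cong (λ z → (columnStart j + z) % n) t+d≡ ⟩
    (columnStart j + (k₁ + m * n)) % n  ≡⟨ cong (_% n) (ℕP.+-assoc (columnStart j) k₁ (m * n)) ⟨
    (columnStart j + k₁ + m * n) % n    ≡⟨ [m+kn]%n≡m%n (columnStart j + k₁) m n ⟩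
    (columnStart j + k₁) % n            ≡⟨ diag-+ (ℕP.<⇒≤ k₁<n) j<n ⟩
    j                                   ∎
    where open ≡-Reasoning

  column-filled : ∀ {j t} → j < n → t < k → cell ((columnStart j + t) % n) j ≡ just (reversed k (colEntry j) t)
  column-filled {j} {t} j<n t<k = begin
    cell x j                      ≡⟨ cell-filled (subst (_< k) (sym diag≡d) d<k) ⟩
    just (entry x (diag x j))     ≡⟨ cong (just ∘ entry x) diag≡d ⟩
    just (entry x d)              ≡⟨ cong (λ z → just (entry z d)) row≡x ⟨
    just (entry (diag d j) d)     ∎
    where
    open ≡-Reasoning
    x = (columnStart j + t) % n
    d = k ∸ suc t
    d<k : d < k
    d<k = ℕP.∸-monoʳ-< (s≤s z≤n) t<k
    d<n : d < n
    d<n = ℕP.<-≤-trans d<k k≤n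
    on-column : (x + d) % n ≡ j
    on-column = columnStart-+ 0 j<n (trans (cong ℕ.pred (ℕP.m+[n∸m]≡n t<k)) (sym (ℕP.+-identityʳ k₁)))
    diag≡d : diag x j ≡ d
    diag≡d = diag-of (m%n<n (columnStart j + t) n) d<n on-column
    row≡x : diag d j ≡ x
    row≡x = diag-of d<n (m%n<n (columnStart j + t) n) (trans (cong (_% n) (ℕP.+-comm d x)) on-column)

  column-empty : ∀ {j t} → j < n → k ≤ t → t < n → cell ((columnStart j + t) % n) j ≡ nothing
  column-empty {j} {t} j<n k≤t t<n = cell-empty (subst (k ≤_) (sym diag≡d) k≤d)
    where
    d = k₁ + (n ∸ t)
    k≤d : k ≤ d
    k≤d = subst (_≤ d) (ℕP.+-comm k₁ 1) (ℕP.+-monoʳ-≤ k₁ (ℕP.m<n⇒0<n∸m t<n))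
    d<n : d < n
    d<n = begin-strict
      k₁ + (n ∸ t)    ≡⟨ ℕP.+-comm k₁ (n ∸ t) ⟩
      (n ∸ t) + k₁    <⟨ ℕP.+-monoʳ-< (n ∸ t) (ℕP.<-≤-trans (ℕP.n<1+n k₁) k≤t) ⟩
      (n ∸ t) + t     ≡⟨ ℕP.m∸n+n≡m (ℕP.<⇒≤ t<n) ⟩
      n               ∎
      where open ℕP.≤-Reasoning
    rearrange : t + d ≡ k₁ + 1 * n
    rearrange = begin
      t + (k₁ + (n ∸ t))   ≡⟨ solve-around t k₁ (n ∸ t) ⟩
      k₁ + (t + (n ∸ t))   ≡⟨ cong (λ z → k₁ + z) (ℕP.m+[n∸m]≡n (ℕP.<⇒≤ t<n)) ⟩
      k₁ + n               ≡⟨ cong (λ z → k₁ + z) (ℕP.+-identityʳ n) ⟨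
      k₁ + 1 * n           ∎
      where
      open ≡-Reasoning
      solve-around : ∀ a b c → a + (b + c) ≡ b + (a + c)
      solve-around = solve-ℕ
    diag≡d : diag ((columnStart j + t) % n) j ≡ d
    diag≡d = diag-of (m%n<n (columnStart j + t) n) d<n (columnStart-+ 1 j<n rearrange)

  colEntries-rotation : ∀ j → ∃ λ r →
    colEntries array j ≡ applyUpTo (λ t → cyclic k (reversed k (colEntry (toℕ j))) (r + t)) k
  colEntries-rotation j =
    map₂ (trans (mapMaybe-allFin n (λ i → cell i (toℕ j))))
         (mapMaybe-window (λ i → cell i (toℕ j)) (reversed k (colEntry (toℕ j))) (columnStart (toℕ j))
                          (m%n<n (toℕ j + (n ∸ k₁)) n) k≤n (λ _ → column-filled (toℕ<n j)) (λ _ → column-empty (toℕ<n j)))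

  data Shape : Set where
    multiple offMultiple low deep : ℕ → Shape

  multiple-injective : ∀ {a b} → multiple a ≡ multiple b → a ≡ b
  multiple-injective refl = refl

  offMultiple-injective : ∀ {a b} → offMultiple a ≡ offMultiple b → a ≡ b
  offMultiple-injective refl = refl

  low-injective : ∀ {a b} → low a ≡ low b → a ≡ b
  low-injective refl = refl

  deep-injective : ∀ {a b} → deep a ≡ deep b → a ≡ b
  deep-injective refl = refl

  value : Shape → ℤ
  value (multiple m)    = ℤ.- (+ (n * m))
  value (offMultiple m) = ℤ.- (+ (n′ + n * m))
  value (low a)         = + suc a
  value (deep a)        = ℤ.- (+ (n * k₁ + suc a))

  Valid : Shape → Set
  Valid (multiple m)    = m ≤ k₁
  Valid (offMultiple m) = m < k₁
  Valid (low a)         = a < n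
  Valid (deep a)        = a < n

  1≤n′ : 1 ≤ n′
  1≤n′ = ℕP.≤-pred (ℕP.≤-trans (subst (2 ≤_) (sym k≡4+p′*4) (s≤s (s≤s z≤n))) k≤n)

  multiple≢offMultiple : ∀ m m′ → n * m ≢ n′ + n * m′
  multiple≢offMultiple m m′ eq with m ℕP.≤? m′
  ... | yes m≤m′ = ℕP.<-irrefl eq (ℕP.≤-<-trans (ℕP.*-monoʳ-≤ n m≤m′) (ℕP.m<n+m (n * m′) 1≤n′))
  ... | no  m≰m′ = ℕP.<-irrefl (sym eq) (ℕP.<-≤-trans (ℕP.+-monoˡ-< (n * m′) (ℕP.n<1+n n′))
                     (subst (_≤ n * m) (ℕP.*-suc n m′) (ℕP.*-monoʳ-≤ n (ℕP.≰⇒> m≰m′))))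

  multiple≢deep : ∀ {m} a → m ≤ k₁ → n * m ≢ n * k₁ + suc a
  multiple≢deep a m≤k₁ eq = ℕP.<-irrefl eq (ℕP.≤-<-trans (ℕP.*-monoʳ-≤ n m≤k₁) (ℕP.m<m+n (n * k₁) (s≤s z≤n)))

  offMultiple≢deep : ∀ {m} a → m < k₁ → n′ + n * m ≢ n * k₁ + suc a
  offMultiple≢deep {m} a m<k₁ eq = ℕP.<-irrefl eq (ℕP.<-≤-trans (ℕP.+-monoˡ-< (n * m) (ℕP.n<1+n n′))
    (subst (_≤ n * k₁ + suc a) (ℕP.*-suc n m) (ℕP.≤-trans (ℕP.*-monoʳ-≤ n m<k₁) (ℕP.m≤m+n (n * k₁) (suc a)))))

  neg≢pos : ∀ a b → ℤ.- (+ a) ≢ + suc b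
  neg≢pos zero    b ()
  neg≢pos (suc a) b ()

  neg-+-injective : ∀ {a b} → ℤ.- (+ a) ≡ ℤ.- (+ b) → a ≡ b
  neg-+-injective eq = ℤP.+-injective (ℤP.neg-injective eq)

  value-injective : ∀ s s′ → Valid s → Valid s′ → value s ≡ value s′ → s ≡ s′
  value-injective (multiple m)    (multiple m′)    _ _ eq = cong multiple (ℕP.*-cancelˡ-≡ m m′ n (neg-+-injective eq))
  value-injective (multiple m)    (offMultiple m′) _ _ eq = ⊥-elim (multiple≢offMultiple m m′ (neg-+-injective eq))
  value-injective (multiple m)    (low a)          _ _ eq = ⊥-elim (neg≢pos _ a eq)
  value-injective (multiple m)    (deep a)         v _ eq = ⊥-elim (multiple≢deep a v (neg-+-injective eq))
  value-injective (offMultiple m) (multiple m′)    _ _ eq = ⊥-elim (multiple≢offMultiple m′ m (sym (neg-+-injective eq)))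
  value-injective (offMultiple m) (offMultiple m′) _ _ eq =
    cong offMultiple (ℕP.*-cancelˡ-≡ m m′ n (ℕP.+-cancelˡ-≡ n′ _ _ (neg-+-injective eq)))
  value-injective (offMultiple m) (low a)          _ _ eq = ⊥-elim (neg≢pos _ a eq)
  value-injective (offMultiple m) (deep a)         v _ eq = ⊥-elim (offMultiple≢deep a v (neg-+-injective eq))
  value-injective (low a)         (multiple m)     _ _ eq = ⊥-elim (neg≢pos _ a (sym eq))
  value-injective (low a)         (offMultiple m)  _ _ eq = ⊥-elim (neg≢pos _ a (sym eq))
  value-injective (low a)         (low b)          _ _ eq = cong low (ℕP.suc-injective (ℤP.+-injective eq))
  value-injective (low a)         (deep b)         _ _ eq = ⊥-elim (neg≢pos _ a (sym eq))
  value-injective (deep a)        (multiple m)     _ v eq = ⊥-elim (multiple≢deep a v (sym (neg-+-injective eq)))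
  value-injective (deep a)        (offMultiple m)  _ v eq = ⊥-elim (offMultiple≢deep a v (sym (neg-+-injective eq)))
  value-injective (deep a)        (low b)          _ _ eq = ⊥-elim (neg≢pos _ b eq)
  value-injective (deep a)        (deep b)         _ _ eq = cong deep (ℕP.suc-injective (ℕP.+-cancelˡ-≡ (n * k₁) _ _ (neg-+-injective eq)))

  n*k≡n*k₁+n : n * k ≡ n * k₁ + n
  n*k≡n*k₁+n = trans (ℕP.*-suc n k₁) (ℕP.+-comm n _)

  value-bounded : ∀ s → Valid s → ℤ.∣ value s ∣ ≤ n * k
  value-bounded (multiple m) m≤k₁ = subst (_≤ n * k) (sym (ℤP.∣-i∣≡∣i∣ (+ (n * m))))
    (ℕP.*-monoʳ-≤ n (ℕP.≤-trans m≤k₁ (ℕP.n≤1+n k₁)))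
  value-bounded (offMultiple m) m<k₁ = subst (_≤ n * k) (sym (ℤP.∣-i∣≡∣i∣ (+ (n′ + n * m))))
    (ℕP.≤-trans (ℕP.<⇒≤ (ℕP.+-monoˡ-< (n * m) (ℕP.n<1+n n′)))
      (subst (_≤ n * k) (ℕP.*-suc n m) (ℕP.*-monoʳ-≤ n (ℕP.≤-trans m<k₁ (ℕP.n≤1+n k₁)))))
  value-bounded (low a) a<n = ℕP.≤-trans a<n (subst (n ≤_) (sym n*k≡n*k₁+n) (ℕP.m≤n+m n _))
  value-bounded (deep a) a<n = subst (_≤ n * k) (sym (ℤP.∣-i∣≡∣i∣ (+ (n * k₁ + suc a))))
    (subst (n * k₁ + suc a ≤_) (sym n*k≡n*k₁+n) (ℕP.+-monoʳ-≤ (n * k₁) a<n))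

  value-≡[mod] : ∀ {s s′} → Valid s → Valid s′ → value s ≡[mod M ] value s′ → s ≡ s′
  value-≡[mod] {s} {s′} v v′ cong≡ = value-injective s s′ v v′ (≡[mod]-small⇒≡ cong≡ (s≤s (begin
    ℤ.∣ value s ∣ + ℤ.∣ value s′ ∣   ≤⟨ ℕP.+-mono-≤ (value-bounded s v) (value-bounded s′ v′) ⟩
    n * k + n * k                   ≡⟨ double n k ⟩
    2 * n * k                       ∎)))
    where
    open ℕP.≤-Reasoning
    double : ∀ a b → a * b + a * b ≡ 2 * a * b
    double = solve-ℕ

  -- The position r of a partial sum within its block; in a row the multiples −2qn and −(2q+1)n
  -- of n sit at r = 0 and r = 2.
  tag : Shape → ℕ
  tag (multiple m)    = 2 * (m % 2)
  tag (offMultiple _) = 2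
  tag (low _)         = 1
  tag (deep _)        = 3

  -- A balanced noise cancels over each block, so a block starting at −2qn ends at −2(q+1)n,
  -- and the last one at 0.
  module Blocks (E : ℕ → ℤ) (noise : ℕ → ℕ → ℕ)
    (E-block : ∀ {q r} → q < p → r < 4 → E (r + q * 4) ≡ sign r (+ (n * band q r + suc (noise q r))))
    (balanced : ∀ q → noise q 0 + noise q 3 ≡ noise q 1 + noise q 2) where

    private
      S : ℕ → ℤ
      S = psum E

    psum-low : ∀ {q} → q < p → S (q * 4) ≡ value (multiple (2 * q)) → S (1 + q * 4) ≡ value (low (noise q 0))
    psum-low {q} q<p S≡ = trans (cong₂ ℤ._+_ S≡ (E-block q<p (s≤s z≤n))) (cancel (+ (n * (2 * q))) (+ suc (noise q 0)))
      where
      cancel : ∀ a e → ℤ.- a ℤ.+ (a ℤ.+ e) ≡ e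
      cancel = solve-∀

    psum-mid : ∀ {q} → q < p → S (q * 4) ≡ value (multiple (2 * q)) →
               S (2 + q * 4) ≡ + suc (noise q 0) ℤ.- + (n * suc (2 * q) + suc (noise q 1))
    psum-mid q<p S≡ = cong₂ ℤ._+_ (psum-low q<p S≡) (E-block q<p (s≤s (s≤s z≤n)))

    psum-deep : ∀ {q} → q < p → S (q * 4) ≡ value (multiple (2 * q)) → S (3 + q * 4) ≡ value (deep (noise q 3))
    psum-deep {q} q<p S≡ = begin
      S (2 + q * 4) ℤ.+ E (2 + q * 4)
        ≡⟨ cong₂ ℤ._+_ (psum-mid q<p S≡) (E-block q<p (s≤s (s≤s (s≤s z≤n)))) ⟩
      (+ suc e₀ ℤ.- (a ℤ.+ + suc e₁)) ℤ.- (b ℤ.+ + suc e₂)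
        ≡⟨ regroup a b (+ e₀) (+ e₁) (+ e₂) (+ e₃) ⟩
      ℤ.- (a ℤ.+ b ℤ.+ + suc e₃) ℤ.+ (+ (e₀ + e₃) ℤ.- + (e₁ + e₂))
        ≡⟨ cong (λ z → ℤ.- (a ℤ.+ b ℤ.+ + suc e₃) ℤ.+ (+ z ℤ.- + (e₁ + e₂))) (balanced q) ⟩
      ℤ.- (a ℤ.+ b ℤ.+ + suc e₃) ℤ.+ (+ (e₁ + e₂) ℤ.- + (e₁ + e₂))
        ≡⟨ cong (λ z → ℤ.- (a ℤ.+ b ℤ.+ + suc e₃) ℤ.+ z) (ℤP.+-inverseʳ (+ (e₁ + e₂))) ⟩
      ℤ.- (a ℤ.+ b ℤ.+ + suc e₃) ℤ.+ 0ℤ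
        ≡⟨ ℤP.+-identityʳ _ ⟩
      ℤ.- (+ (n * suc (2 * q) + n * band q 2 + suc e₃))
        ≡⟨ cong (λ m → ℤ.- (+ (m + suc e₃))) (n*k₁-split q<p) ⟩
      value (deep e₃)
        ∎
      where
      open ≡-Reasoning
      e₀ = noise q 0
      e₁ = noise q 1
      e₂ = noise q 2
      e₃ = noise q 3
      a = + (n * suc (2 * q))
      b = + (n * band q 2)
      regroup : ∀ a b e₀ e₁ e₂ e₃ → (+ 1 ℤ.+ e₀ ℤ.- (a ℤ.+ (+ 1 ℤ.+ e₁))) ℤ.- (b ℤ.+ (+ 1 ℤ.+ e₂))
                                  ≡ ℤ.- (a ℤ.+ b ℤ.+ (+ 1 ℤ.+ e₃)) ℤ.+ ((e₀ ℤ.+ e₃) ℤ.- (e₁ ℤ.+ e₂))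
      regroup = solve-∀

    psum-next : ∀ {q} → q < p → S (q * 4) ≡ value (multiple (2 * q)) →
                S (4 + q * 4) ≡ ℤ.- (+ (n * k₁)) ℤ.+ + (n * band q 3)
    psum-next {q} q<p S≡ = trans (cong₂ ℤ._+_ (psum-deep q<p S≡) (E-block q<p (s≤s (s≤s (s≤s (s≤s z≤n))))))
      (cancel (+ (n * k₁)) (+ (n * band q 3)) (+ suc (noise q 3)))
      where
      cancel : ∀ a b e → ℤ.- (a ℤ.+ e) ℤ.+ (b ℤ.+ e) ≡ ℤ.- a ℤ.+ b
      cancel = solve-∀

    psum-multiple : ∀ {q} → q < p → S (q * 4) ≡ value (multiple (2 * q))
    psum-multiple {zero}  _    = cong (λ m → ℤ.- (+ m)) (sym (ℕP.*-zeroʳ n))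
    psum-multiple {suc q} sq<p = begin
      S (4 + q * 4)                                       ≡⟨ psum-next q<p (psum-multiple q<p) ⟩
      ℤ.- (+ (n * k₁)) ℤ.+ + (n * band q 3)               ≡⟨ cong (λ m → ℤ.- (+ m) ℤ.+ + (n * band q 3)) (n*k₁-split′ sq<p) ⟨
      ℤ.- (+ (n * (2 * suc q)) ℤ.+ b) ℤ.+ b               ≡⟨ cancel (+ (n * (2 * suc q))) b ⟩
      value (multiple (2 * suc q))                        ∎
      where
      open ≡-Reasoning
      q<p = ℕP.<-trans (ℕP.n<1+n q) sq<p
      b = + (n * band q 3)
      cancel : ∀ a b → ℤ.- (a ℤ.+ b) ℤ.+ b ≡ ℤ.- a
      cancel = solve-∀

    psum-closed : S k ≡ 0ℤ
    psum-closed = begin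
      S k                                         ≡⟨ cong S k≡4+p′*4 ⟩
      S (4 + p′ * 4)                              ≡⟨ psum-next (ℕP.n<1+n p′) (psum-multiple (ℕP.n<1+n p′)) ⟩
      ℤ.- (+ (n * k₁)) ℤ.+ + (n * band p′ 3)      ≡⟨ cong (λ m → ℤ.- (+ (n * k₁)) ℤ.+ + (n * m)) band-last ⟩
      ℤ.- (+ (n * k₁)) ℤ.+ + (n * k₁)             ≡⟨ ℤP.+-inverseˡ (+ (n * k₁)) ⟩
      0ℤ                                          ∎
      where open ≡-Reasoning

    module _ (middle : ℕ → Shape)
      (psum-middle : ∀ {q} → q < p → + suc (noise q 0) ℤ.- + (n * suc (2 * q) + suc (noise q 1)) ≡ value (middle q))
      (middle-valid : ∀ {q} → q < p → Valid (middle q))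
      (tag-middle : ∀ q → tag (middle q) ≡ 2)
      (middle-injective : ∀ {q q′} → q < p → q′ < p → middle q ≡ middle q′ → q ≡ q′)
      (noise-< : ∀ q r → noise q r < n)
      (noise-injective₀ : ∀ {q q′} → q < p → q′ < p → noise q 0 ≡ noise q′ 0 → q ≡ q′)
      (noise-injective₃ : ∀ {q q′} → q < p → q′ < p → noise q 3 ≡ noise q′ 3 → q ≡ q′) where

      private
        shape : ℕ → ℕ → Shape
        shape q 0 = multiple (2 * q)
        shape q 1 = low (noise q 0)
        shape q 2 = middle q
        shape q (suc (suc (suc _))) = deep (noise q 3)

        psum-shape : ∀ {q r} → q < p → r < 4 → S (r + q * 4) ≡ value (shape q r)
        psum-shape {r = 0} q<p _ = psum-multiple q<p
        psum-shape {r = 1} q<p _ = psum-low q<p (psum-multiple q<p)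
        psum-shape {r = 2} q<p _ = trans (psum-mid q<p (psum-multiple q<p)) (psum-middle q<p)
        psum-shape {r = 3} q<p _ = psum-deep q<p (psum-multiple q<p)
        psum-shape {r = suc (suc (suc (suc _)))} _ (s≤s (s≤s (s≤s (s≤s ()))))

        shape-valid : ∀ {q r} → q < p → Valid (shape q r)
        shape-valid {q} {0} q<p = ℕP.<⇒≤ (2q<k₁ q<p)
        shape-valid {q} {1} q<p = noise-< q 0
        shape-valid {q} {2} q<p = middle-valid q<p
        shape-valid {q} {suc (suc (suc _))} q<p = noise-< q 3

        tag-shape : ∀ q {r} → r < 4 → tag (shape q r) ≡ r
        tag-shape q {0} _ = cong (2 *_) (trans (cong (_% 2) (ℕP.*-comm 2 q)) (m*n%n≡0 q 2))
        tag-shape q {1} _ = refl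
        tag-shape q {2} _ = tag-middle q
        tag-shape q {3} _ = refl
        tag-shape q {suc (suc (suc (suc _)))} (s≤s (s≤s (s≤s (s≤s ()))))

        same-block : ∀ {q q′} r → q < p → q′ < p → shape q r ≡ shape q′ r → q ≡ q′
        same-block {q} {q′} 0 _   _    eq = ℕP.*-cancelˡ-≡ q q′ 2 (multiple-injective eq)
        same-block 1 q<p q′<p eq = noise-injective₀ q<p q′<p (low-injective eq)
        same-block 2 q<p q′<p eq = middle-injective q<p q′<p eq
        same-block (suc (suc (suc _))) q<p q′<p eq = noise-injective₃ q<p q′<p (deep-injective eq)

        shape-injective : ∀ {q q′ r r′} → q < p → q′ < p → r < 4 → r′ < 4 →
                          shape q r ≡ shape q′ r′ → q ≡ q′ × r ≡ r′
        shape-injective {q} {q′} {r} {r′} q<p q′<p r<4 r′<4 eq =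
          same-block r q<p q′<p (subst (λ z → shape q r ≡ shape q′ z) (sym r≡r′) eq) , r≡r′
          where
          r≡r′ : r ≡ r′
          r≡r′ = trans (sym (tag-shape q r<4)) (trans (cong tag eq) (tag-shape q′ r′<4))

        quotient-< : ∀ {x} → x < k → x / 4 < p
        quotient-< {x} x<k = m<n*o⇒m/o<n (subst (x <_) (ℕP.*-comm 4 p) x<k)

        psum-at : ∀ {x} → x < k → S x ≡ value (shape (x / 4) (x % 4))
        psum-at {x} x<k = trans (cong S (m≡m%n+[m/n]*n x 4)) (psum-shape (quotient-< x<k) (m%n<n x 4))

      psum-distinct : DistinctPartialSums M k E
      psum-distinct {x} {y} x<k y<k x≡y = begin
        x                      ≡⟨ m≡m%n+[m/n]*n x 4 ⟩
        x % 4 + (x / 4) * 4    ≡⟨ cong₂ (λ r q → r + q * 4) (proj₂ same) (proj₁ same) ⟩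
        y % 4 + (y / 4) * 4    ≡⟨ m≡m%n+[m/n]*n y 4 ⟨
        y                      ∎
        where
        open ≡-Reasoning
        same : x / 4 ≡ y / 4 × x % 4 ≡ y % 4
        same = shape-injective (quotient-< x<k) (quotient-< y<k) (m%n<n x 4) (m%n<n y 4)
          (value-≡[mod] (shape-valid {r = x % 4} (quotient-< x<k)) (shape-valid {r = y % 4} (quotient-< y<k))
            (subst₂ (λ a b → a ≡[mod M ] b) (psum-at x<k) (psum-at y<k) x≡y))

  module Row (i : ℕ) where

    noise : ℕ → ℕ → ℕ
    noise q r = (i + offset q r) % n

    open Blocks (entry i) noise (λ {q} _ r<4 → entry-block i q r<4) (λ _ → refl)

    row-closed : psum (entry i) k ≡ 0ℤ
    row-closed = psum-closed

    row-distinct : DistinctPartialSums M k (entry i)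
    row-distinct = psum-distinct (λ q → multiple (suc (2 * q)))
      (λ {q} _ → cancel (+ (n * suc (2 * q))) (+ suc (noise q 0)))
      (λ q<p → ℕP.<⇒≤ (2q+1<k₁ q<p))
      (λ q → cong (2 *_) (trans (cong (λ m → suc m % 2) (ℕP.*-comm 2 q)) ([m+kn]%n≡m%n 1 q 2)))
      (λ _ _ eq → ℕP.*-cancelˡ-≡ _ _ 2 (ℕP.suc-injective (multiple-injective eq)))
      (λ q r → m%n<n (i + offset q r) n)
      (λ q<p q′<p eq → ℕP.*-cancelˡ-≡ _ _ 2 (%-+-injective i n (2q<n q<p) (2q<n q′<p) eq))
      (λ q<p q′<p eq → ℕP.*-cancelˡ-≡ _ _ 2 (ℕP.suc-injective (ℕP.suc-injective
                          (%-+-injective i n (2q+2<n q<p) (2q+2<n q′<p) eq))))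
      where
      cancel : ∀ a e → e ℤ.- (a ℤ.+ e) ≡ ℤ.- a
      cancel = solve-∀

  module Column (j : ℕ) where

    shift : ℕ → ℕ → ℕ
    shift q 0 = 2 * q
    shift q 1 = suc (2 * q)
    shift q 2 = 2 * q
    shift q (suc (suc (suc _))) = suc (2 * q)

    shift+offset : ∀ q {r} → r < 4 → shift q r + offset q r ≡ r + q * 4
    shift+offset q {0} _ = identity q
      where
      identity : ∀ q → 2 * q + 2 * q ≡ q * 4
      identity = solve-ℕ
    shift+offset q {1} _ = identity q
      where
      identity : ∀ q → suc (2 * q) + 2 * q ≡ 1 + q * 4
      identity = solve-ℕ
    shift+offset q {2} _ = identity q
      where
      identity : ∀ q → 2 * q + suc (suc (2 * q)) ≡ 2 + q * 4
      identity = solve-ℕ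
    shift+offset q {3} _ = identity q
      where
      identity : ∀ q → suc (2 * q) + suc (suc (2 * q)) ≡ 3 + q * 4
      identity = solve-ℕ
    shift+offset q {suc (suc (suc (suc _)))} (s≤s (s≤s (s≤s (s≤s ()))))

    noise : ℕ → ℕ → ℕ
    noise q r = (j + (n ∸ shift q r)) % n

    colEntry-block : ∀ {q r} → q < p → r < 4 → colEntry j (r + q * 4) ≡ sign r (+ (n * band q r + suc (noise q r)))
    colEntry-block {q} {r} q<p r<4 =
      trans (entry-block (diag (r + q * 4) j) q r<4)
            (cong (λ m → sign r (+ (n * band q r + suc m)))
                  (diag-+-offset {j = j} (shift+offset q r<4) (ℕP.<⇒≤ (ℕP.<-≤-trans (block-< q<p r<4) k≤n))))

    open Blocks (colEntry j) noise colEntry-block (λ q → ℕP.+-comm (noise q 0) (noise q 1))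

    noise₀≡suc-noise₁ : ∀ {q} → q < p → noise q 0 ≡ suc (noise q 1) % n
    noise₀≡suc-noise₁ {q} q<p = begin
      (j + (n ∸ 2 * q)) % n              ≡⟨ cong (λ m → (j + m) % n) (ℕP.+-∸-assoc 1 (ℕP.<⇒≤ (2q+1<n q<p))) ⟩
      (j + suc x) % n                    ≡⟨ cong (_% n) (trans (ℕP.+-suc j x) (ℕP.+-comm 1 (j + x))) ⟩
      (j + x + 1) % n                    ≡⟨ %-+ˡ (j + x) 1 n ⟨
      ((j + x) % n + 1) % n              ≡⟨ cong (_% n) (ℕP.+-comm _ 1) ⟩
      suc ((j + x) % n) % n              ∎
      where
      open ≡-Reasoning
      x = n ∸ suc (2 * q)

    -- The middle partial sum of block q is −(n−1) − 2qn, or −(n−1) − (2q+1)n when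
    -- noise q 1 + 1 wraps around to noise q 0 = 0.
    carry : ℕ → ℕ
    carry q with suc (noise q 1) <? n
    ... | yes _ = 0
    ... | no  _ = 1

    carry-< : ∀ q → carry q < 2
    carry-< q with suc (noise q 1) <? n
    ... | yes _ = s≤s z≤n
    ... | no  _ = s≤s (s≤s z≤n)

    psum-middle : ∀ {q} → q < p →
      + suc (noise q 0) ℤ.- + (n * suc (2 * q) + suc (noise q 1)) ≡ value (offMultiple (carry q + q * 2))
    psum-middle {q} q<p with suc (noise q 1) <? n
    ... | yes lt = begin
      + suc (noise q 0) ℤ.- + (n * suc (2 * q) + suc e₁)
        ≡⟨ cong₂ (λ a b → + suc a ℤ.- + (b + suc e₁)) (trans (noise₀≡suc-noise₁ q<p) (m<n⇒m%n≡m lt))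
                 (trans (ℕP.*-suc n (2 * q)) (cong (λ m → n + n * m) (ℕP.*-comm 2 q))) ⟩
      + 1 ℤ.+ (+ 1 ℤ.+ + e₁) ℤ.- (+ 1 ℤ.+ + n′ ℤ.+ + (n * (q * 2)) ℤ.+ (+ 1 ℤ.+ + e₁))
        ≡⟨ cancel (+ e₁) (+ n′) (+ (n * (q * 2))) ⟩
      ℤ.- (+ (n′ + n * (q * 2)))
        ∎
      where
      open ≡-Reasoning
      e₁ = noise q 1
      cancel : ∀ e a b → + 1 ℤ.+ (+ 1 ℤ.+ e) ℤ.- (+ 1 ℤ.+ a ℤ.+ b ℤ.+ (+ 1 ℤ.+ e)) ≡ ℤ.- (a ℤ.+ b)
      cancel = solve-∀
    ... | no ¬lt = begin
      + suc (noise q 0) ℤ.- + (n * suc (2 * q) + suc (noise q 1))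
        ≡⟨ cong₂ (λ a b → + suc a ℤ.- + (n * suc (2 * q) + suc b)) noise₀≡0 noise₁≡n′ ⟩
      + 1 ℤ.- + (n * suc (2 * q) + suc n′)
        ≡⟨ cong (λ m → + 1 ℤ.- + (n * suc m + suc n′)) (ℕP.*-comm 2 q) ⟩
      + 1 ℤ.- (+ (n * (1 + q * 2)) ℤ.+ (+ 1 ℤ.+ + n′))
        ≡⟨ cancel (+ n′) (+ (n * (1 + q * 2))) ⟩
      ℤ.- (+ (n′ + n * (1 + q * 2)))
        ∎
      where
      open ≡-Reasoning
      noise₁≡n′ : noise q 1 ≡ n′
      noise₁≡n′ = ℕP.≤-antisym (ℕP.≤-pred (m%n<n (j + (n ∸ suc (2 * q))) n)) (ℕP.≤-pred (ℕP.≮⇒≥ ¬lt))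
      noise₀≡0 : noise q 0 ≡ 0
      noise₀≡0 = trans (noise₀≡suc-noise₁ q<p) (trans (cong (λ m → suc m % n) noise₁≡n′) (n%n≡0 n))
      cancel : ∀ a x → + 1 ℤ.- (x ℤ.+ (+ 1 ℤ.+ a)) ≡ ℤ.- (a ℤ.+ x)
      cancel = solve-∀

    column-closed : psum (colEntry j) k ≡ 0ℤ
    column-closed = psum-closed

    column-distinct : DistinctPartialSums M k (colEntry j)
    column-distinct = psum-distinct (λ q → offMultiple (carry q + q * 2)) psum-middle
      (λ {q} q<p → ℕP.≤-<-trans (ℕP.+-monoˡ-≤ (q * 2) (ℕP.≤-pred (carry-< q)))
                     (subst (λ m → suc m < k₁) (ℕP.*-comm 2 q) (2q+1<k₁ q<p)))
      (λ _ → refl)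
      (λ {q} {q′} _ _ eq → trans (sym ([r+q*d]/d≡q q (carry-< q)))
                             (trans (cong (_/ 2) (offMultiple-injective eq)) ([r+q*d]/d≡q q′ (carry-< q′))))
      (λ q r → m%n<n (j + (n ∸ shift q r)) n)
      (λ q<p q′<p eq → ℕP.*-cancelˡ-≡ _ _ 2 (%-+-∸-injective j n (2q<n q<p) (2q<n q′<p) eq))
      (λ q<p q′<p eq → ℕP.*-cancelˡ-≡ _ _ 2 (ℕP.suc-injective
                          (%-+-∸-injective j n (2q+1<n q<p) (2q+1<n q′<p) eq)))

  band-low : ∀ q {r} → r < 2 → band q r ≡ r + q * 2
  band-low q {0} _ = ℕP.*-comm 2 q
  band-low q {1} _ = cong suc (ℕP.*-comm 2 q)
  band-low q {suc (suc _)} (s≤s (s≤s ()))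

  band-high : ∀ {c} → c < 2 * p → ∃₂ λ q r → q < p × r < 4 × band q r ≡ k₁ ∸ c
  band-high {c} c<2p = from-halves (c % 2) (c / 2) (m%n<n c 2) (m<n*o⇒m/o<n (subst (c <_) (ℕP.*-comm 2 p) c<2p))
                                   (m≡m%n+[m/n]*n c 2)
    where
    from-halves : ∀ r h → r < 2 → h < p → c ≡ r + h * 2 → ∃₂ λ q r → q < p × r < 4 × band q r ≡ k₁ ∸ c
    from-halves 0 zero _ _ c≡0 = p′ , 3 , ℕP.n<1+n p′ , ℕP.n<1+n 3 , trans band-last (cong (k₁ ∸_) (sym c≡0))
    from-halves 0 (suc h) _ sh<p c≡ = h , 3 , ℕP.<-trans (ℕP.n<1+n h) sh<p , ℕP.n<1+n 3 ,
      trans (band-3 sh<p) (cong (k₁ ∸_) (trans (cong (λ m → suc (suc m)) (ℕP.*-comm 2 h)) (sym c≡)))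
    from-halves 1 h _ h<p c≡ = h , 2 , h<p , s≤s (s≤s (s≤s z≤n)) ,
      cong (k₁ ∸_) (trans (cong suc (ℕP.*-comm 2 h)) (sym c≡))
    from-halves (suc (suc _)) _ (s≤s (s≤s ())) _ _

  band-surjective : ∀ {b} → b < k → ∃₂ λ q r → q < p × r < 4 × band q r ≡ b
  band-surjective {b} b<k with b <? 2 * p
  ... | yes b<2p = b / 2 , b % 2 , m<n*o⇒m/o<n (subst (b <_) (ℕP.*-comm 2 p) b<2p) ,
                   ℕP.<-trans (m%n<n b 2) (s≤s (s≤s (s≤s z≤n))) ,
                   trans (band-low (b / 2) (m%n<n b 2)) (sym (m≡m%n+[m/n]*n b 2))
  ... | no  b≮2p with band-high c<2p
    where
    c<2p : k₁ ∸ b < 2 * p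
    c<2p = ℕP.≤-<-trans (ℕP.∸-monoʳ-≤ k₁ (ℕP.≮⇒≥ b≮2p)) (begin-strict
      k₁ ∸ 2 * p                  ≡⟨ cong (_∸ 2 * p) (identity p′) ⟩
      2 * p + suc (2 * p′) ∸ 2 * p ≡⟨ ℕP.m+n∸m≡n (2 * p) _ ⟩
      suc (2 * p′)                <⟨ ℕP.n<1+n _ ⟩
      suc (suc (2 * p′))          ≡⟨ ℕP.*-suc 2 p′ ⟨
      2 * p                       ∎)
      where
      open ℕP.≤-Reasoning
      identity : ∀ a → a + 3 * suc a ≡ 2 * suc a + suc (2 * a)
      identity = solve-ℕ
  ... | q , r , q<p , r<4 , band≡ = q , r , q<p , r<4 , trans band≡ (ℕP.m∸[m∸n]≡n (ℕP.≤-pred b<k))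

  sign-± : ∀ r z → sign r z ≡ z ⊎ sign r z ≡ ℤ.- z
  sign-± 0 z = inj₁ refl
  sign-± 1 z = inj₂ refl
  sign-± 2 z = inj₂ refl
  sign-± (suc (suc (suc _))) z = inj₁ refl

  offset-≤ : ∀ {q} r → q < p → offset q r ≤ n
  offset-≤ 0 q<p = ℕP.<⇒≤ (2q<n q<p)
  offset-≤ 1 q<p = ℕP.<⇒≤ (2q<n q<p)
  offset-≤ (suc (suc _)) q<p = ℕP.<⇒≤ (2q+2<n q<p)

  covers : ∀ x → 1 ≤ x → x ≤ n * k → ∃₂ λ a b → array a b ≡ just (+ x) ⊎ array a b ≡ just (ℤ.- (+ x))
  covers (suc y) _ sy≤nk with band-surjective (m<n*o⇒m/o<n (subst (y <_) (ℕP.*-comm n k) sy≤nk))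
  ... | q , r , q<p , r<4 , band≡ =
    fromℕ< row<n , fromℕ< col<n , Sum.map (trans at-cell ∘ cong just) (trans at-cell ∘ cong just) (sign-± r (+ suc y))
    where
    e = y % n
    row = diag (offset q r) e
    d = r + q * 4
    col = (row + d) % n
    row<n : row < n
    row<n = m%n<n (e + (n ∸ offset q r)) n
    col<n : col < n
    col<n = m%n<n (row + d) n
    magnitude : n * band q r + suc ((row + offset q r) % n) ≡ suc y
    magnitude = begin
      n * band q r + suc ((row + offset q r) % n)
        ≡⟨ cong₂ (λ b e′ → n * b + suc e′) band≡ (diag-+ (offset-≤ r q<p) (m%n<n y n)) ⟩
      n * (y / n) + suc e                           ≡⟨ ℕP.+-suc _ e ⟩
      suc (n * (y / n) + e)                         ≡⟨ cong suc (trans (ℕP.+-comm _ e) (cong (λ m → e + m) (ℕP.*-comm n (y / n)))) ⟩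
      suc (e + (y / n) * n)                         ≡⟨ cong suc (m≡m%n+[m/n]*n y n) ⟨
      suc y                                         ∎
      where open ≡-Reasoning
    at-cell : array (fromℕ< row<n) (fromℕ< col<n) ≡ just (sign r (+ suc y))
    at-cell = begin
      cell (toℕ (fromℕ< row<n)) (toℕ (fromℕ< col<n))   ≡⟨ cong₂ cell (toℕ-fromℕ< row<n) (toℕ-fromℕ< col<n) ⟩
      cell row col                                     ≡⟨ cell-filled (subst (_< k) (sym diag≡d) (block-< q<p r<4)) ⟩
      just (entry row (diag row col))                  ≡⟨ cong (just ∘ entry row) diag≡d ⟩
      just (entry row d)                               ≡⟨ cong just (entry-block row q r<4) ⟩
      just (sign r (+ (n * band q r + suc ((row + offset q r) % n))))  ≡⟨ cong (λ m → just (sign r (+ m))) magnitude ⟩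
      just (sign r (+ suc y))                          ∎
      where
      open ≡-Reasoning
      diag≡d : diag row col ≡ d
      diag≡d = diag-of row<n (ℕP.<-≤-trans (block-< q<p r<4) k≤n) refl

  rotation-properties : ∀ {c} → psum c k ≡ 0ℤ → DistinctPartialSums M k c →
    ∀ {xs} → (∃ λ r → xs ≡ applyUpTo (λ t → cyclic k c (r + t)) k) →
    length xs ≡ k × sumℤ xs ≡ 0ℤ × SimpleMod M xs
  rotation-properties {c} closed distinct (r , refl) =
    length-applyUpTo (λ t → cyclic k c (r + t)) k ,
    sumℤ-rotation {c = c} closed r ,
    simpleMod-rotation {c = c} closed distinct r

  row-properties : ∀ i → length (rowEntries array i) ≡ k × sumℤ (rowEntries array i) ≡ 0ℤ × SimpleMod M (rowEntries array i)
  row-properties i = rotation-properties {c = entry (toℕ i)} row-closed row-distinct (rowEntries-rotation i)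
    where open Row (toℕ i)

  column-properties : ∀ j → length (colEntries array j) ≡ k × sumℤ (colEntries array j) ≡ 0ℤ × SimpleMod M (colEntries array j)
  column-properties j = rotation-properties (reversed-closed {k = k} {c = colEntry y} column-closed)
                                            (reversed-distinct {k = k} {c = colEntry y} column-closed column-distinct)
                                            (colEntries-rotation j)
    where
    y = toℕ j
    open Column y

  zero-sum⇒≡[mod] : ∀ {a} → a ≡ 0ℤ → a ≡[mod M ] 0ℤ
  zero-sum⇒≡[mod] refl = M ∣0

  globallySimpleIntegerHeffter : IsIntegerHeffter n k array × IsGloballySimple n k array
  globallySimpleIntegerHeffter =
    record { heffter    = record { rowCount = proj₁ ∘ row-properties
                                 ; colCount = proj₁ ∘ column-properties
                                 ; rowSum   = zero-sum⇒≡[mod] ∘ proj₁ ∘ proj₂ ∘ row-properties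
                                 ; colSum   = zero-sum⇒≡[mod] ∘ proj₁ ∘ proj₂ ∘ column-properties
                                 ; covers   = covers }
           ; rowSumZero = proj₁ ∘ proj₂ ∘ row-properties
           ; colSumZero = proj₁ ∘ proj₂ ∘ column-properties } ,
    record { rowSimple = proj₂ ∘ proj₂ ∘ row-properties
           ; colSimple = proj₂ ∘ proj₂ ∘ column-properties }

theorem1p4 : (p n : ℕ) → 0 < p → 4 * p ≤ n →
    Σ (Array n) (λ A → IsIntegerHeffter n (4 * p) A × IsGloballySimple n (4 * p) A)
theorem1p4 zero     _        ()  _
theorem1p4 (suc p′) zero     _   ()
theorem1p4 (suc p′) (suc n′) _   4p≤n = array , globallySimpleIntegerHeffter
  where open Construction p′ n′ 4p≤n
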